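{- The scheme $\mathrm{Iab}_C\varphi\leftrightarrow\mathrm{Iab}_{\overline{C}}\neg\varphi$ is not valid: there exist a finite non-empty set of agents $N$, a coalition $C\subseteq N$, a formula $\varphi$, a coalition model $\mathcal{M}$ over $N$ and a state $s$ at which $\mathrm{Iab}_C\varphi\leftrightarrow\mathrm{Iab}_{\overline{C}}\neg\varphi$ is false.
   Context: A coalition is any $C\subseteq N$, $\overline{C}=N\setminus C$. Formulas: $\varphi ::= p \mid \neg\varphi \mid (\varphi\wedge\psi) \mid [C]\varphi \mid \mathrm{Iab}_C\varphi$ over a countable set $\mathrm{Prop}$ of variables, with $\leftrightarrow$ as usual. A coalition model is $\mathcal{M}=(S,\{Act_i\}_{i\in N},o,V)$ with $S$ non-empty, each $Act_i$ non-empty, $o:S\times\prod_{i\in N}Act_i\to S$, $V:\mathrm{Prop}\to 2^S$; $Act_C=\prod_{i\in C}Act_i$ ($Act_\emptyset$ contains only the empty profile). $\mathcal{M},s\models[C]\varphi$ iff there is $\sigma_C\in Act_C$ such that for all $\sigma_{\overline{C}}\in Act_{\overline{C}}$, $\mathcal{M},o(s,\sigma_C,\sigma_{\overline{C}})\models\varphi$; $\mathcal{M},s\models\mathrm{Iab}_C\varphi$ iff $\mathcal{M},s\not\models[C]\varphi$; atoms and Boolean connectives as usual. -}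

module Defs where

open import Data.Nat using (ℕ; suc)
open import Data.Fin using (Fin)
open import Data.Fin.Subset using (Subset; _∈_; _∉_; ∁)
open import Data.Fin.Subset.Properties using (_∈?_; x∉p⇒x∈∁p)
open import Data.Product using (Σ; _×_; _,_)
open import Relation.Nullary using (¬_; yes; no)
open import Data.Empty using (⊥)

-- Agents are Fin n; coalitions are subsets of Fin n; C̄ is the complement ∁ C.
-- Propositional variables: ℕ (countable).
data Formula (n : ℕ) : Set where
  var  : ℕ → Formula n
  ¬ᶠ_  : Formula n → Formula n
  _∧ᶠ_ : Formula n → Formula n → Formula n
  [_]_ : Subset n → Formula n → Formula n
  Iab  : Subset n → Formula n → Formula n

_→ᶠ_ : ∀ {n} → Formula n → Formula n → Formula n
φ →ᶠ ψ = ¬ᶠ (φ ∧ᶠ (¬ᶠ ψ))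

_↔ᶠ_ : ∀ {n} → Formula n → Formula n → Formula n
φ ↔ᶠ ψ = (φ →ᶠ ψ) ∧ᶠ (ψ →ᶠ φ)

record Model (n : ℕ) : Set₁ where
  field
    S        : Set
    s₀       : S                       -- S non-empty
    Act      : Fin n → Set
    actInhab : (i : Fin n) → Act i
    o        : S → ((i : Fin n) → Act i) → S
    V        : ℕ → S → Set

ActC : ∀ {n} → (Fin n → Set) → Subset n → Set
ActC Act C = (i : Fin _) → i ∈ C → Act i

combine : ∀ {n} {Act : Fin n → Set} (C : Subset n) →
          ActC Act C → ActC Act (∁ C) → (i : Fin n) → Act i
combine C σC σC̄ i with i ∈? C
... | yes i∈C = σC i i∈C
... | no  i∉C = σC̄ i (x∉p⇒x∈∁p i∉C)

module _ {n : ℕ} (M : Model n) where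
  open Model M

  _⊨_ : S → Formula n → Set
  s ⊨ var p     = V p s
  s ⊨ (¬ᶠ φ)    = ¬ (s ⊨ φ)
  s ⊨ (φ ∧ᶠ ψ)  = (s ⊨ φ) × (s ⊨ ψ)
  s ⊨ ([ C ] φ) = Σ (ActC Act C) λ σC → (σC̄ : ActC Act (∁ C)) →
                    o s (combine C σC σC̄) ⊨ φ
  s ⊨ Iab C φ   = ¬ (Σ (ActC Act C) λ σC → (σC̄ : ActC Act (∁ C)) →
                    o s (combine C σC σC̄) ⊨ φ)

-- A formula valid in a model can be forced by every coalition, since the action
-- sets are non-empty; so Iab C φ is false. Dually no coalition can force ¬ φ, so
-- Iab D (¬ φ) is true. In a one-state model where p always holds, the two sides
-- of the scheme therefore disagree for any C, complement or not.
module Submission where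

open import Defs
open import Data.Nat using (suc)
open import Data.Fin.Subset using (Subset; ∁; ⊤)
open import Data.Product using (Σ; ∃-syntax; _,_; proj₂)
open import Data.Unit using (tt) renaming (⊤ to Unit)
open import Relation.Nullary using (¬_)

module _ {n} (M : Model n) where
  open Model M

  Valid : Formula n → Set
  Valid φ = ∀ s → _⊨_ M s φ

  anyProfile : (C : Subset n) → ActC Act C
  anyProfile C i _ = actInhab i

  valid⇒forced : ∀ φ → Valid φ → ∀ C s → _⊨_ M s ([ C ] φ)
  valid⇒forced φ valid C s = anyProfile C , λ σC̄ → valid _

  valid⇒¬Iab : ∀ φ → Valid φ → ∀ C s → ¬ _⊨_ M s (Iab C φ)
  valid⇒¬Iab φ valid C s iab = iab (valid⇒forced φ valid C s)

  valid⇒Iab¬ : ∀ φ → Valid φ → ∀ D s → _⊨_ M s (Iab D (¬ᶠ φ))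
  valid⇒Iab¬ φ valid D s (σD , forces¬φ) = forces¬φ (anyProfile (∁ D)) (valid _)

  ↔-refuted : ∀ φ ψ s → ¬ _⊨_ M s φ → _⊨_ M s ψ → ¬ _⊨_ M s (φ ↔ᶠ ψ)
  ↔-refuted φ ψ s ¬φ ψ-holds φ↔ψ = proj₂ φ↔ψ (ψ-holds , ¬φ)

  valid⇒Iab-duality-fails : ∀ φ → Valid φ → ∀ C D s →
                            ¬ _⊨_ M s (Iab C φ ↔ᶠ Iab D (¬ᶠ φ))
  valid⇒Iab-duality-fails φ valid C D s =
    ↔-refuted (Iab C φ) (Iab D (¬ᶠ φ)) s
      (valid⇒¬Iab φ valid C s) (valid⇒Iab¬ φ valid D s)

alwaysTrue : ∀ n → Model n
alwaysTrue n = record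
  { S = Unit ; s₀ = tt ; Act = λ _ → Unit ; actInhab = λ _ → tt
  ; o = λ _ _ → tt ; V = λ _ _ → Unit }

theorem4p23 : ∃[ k ] Σ (Subset (suc k)) λ C → Σ (Formula (suc k)) λ φ →
                Σ (Model (suc k)) λ M → Σ (Model.S M) λ s →
                  ¬ (_⊨_ M s ((Iab C φ) ↔ᶠ (Iab (∁ C) (¬ᶠ φ))))
theorem4p23 = 0 , ⊤ , var 0 , alwaysTrue 1 , tt ,
  valid⇒Iab-duality-fails (alwaysTrue 1) (var 0) (λ _ → tt) ⊤ (∁ ⊤) tt
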